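{- Let $T$ be a non-trivial tree with $\chi_{NL}(T)=k\ge 3$. Then $n(T)\le 2a_1(k)+a_2(k)-2=\frac12(k^3+k^2-2k-4)$, where $a_1(k)=k(k-1)$ and $a_2(k)=\frac{k(k-1)(k-2)}{2}$. Moreover, if equality holds, then $T$ has maximum degree $3$ and contains exactly $k(k-1)$ leaves, $\frac{k(k-1)(k-2)}{2}$ vertices of degree $2$, and $k(k-1)-2$ vertices of degree $3$.
   Context: All graphs are finite, simple, undirected and connected; $n(T)$ is the number of vertices. A $k$-coloring of a graph $G$ is a partition of $V(G)$ into $k$ independent sets (colors). A coloring $\{S_1,\dots,S_k\}$ is neighbor-locating (an NL-coloring) if for any two distinct vertices $u,v$ in the same color class, $\{j: N(u)\cap S_j\neq\emptyset\}\neq\{j: N(v)\cap S_j\neq\emptyset\}$. The neighbor-locating chromatic number $\chi_{NL}(G)$ is the minimum number of colors in an NL-coloring of $G$. -}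

module Defs where

open import Data.Nat using (ℕ; zero; suc; _+_; _*_; _∸_; _^_; _≤_; _<_; _/_)
open import Data.Bool using (Bool; true; false)
open import Data.Fin using (Fin; toℕ)
open import Data.List using (List; length; filter; allFin; map)
open import Data.Nat.ListAction using (sum)
open import Data.Product using (Σ; _×_; ∃; ∃-syntax)
open import Relation.Nullary using (¬_)
open import Relation.Binary.PropositionalEquality using (_≡_; _≢_)
open import Data.Nat using (_≟_; _<?_)
open import Data.Bool using () renaming (_≟_ to _≟ᵇ_)
open import Function.Bundles using (_⇔_)

record Graph (n : ℕ) : Set where
  field
    adj       : Fin n → Fin n → Bool
    symmetric : ∀ u v → adj u v ≡ adj v u
    irreflex  : ∀ u → adj u u ≡ false
open Graph public

Adj : ∀ {n} → Graph n → Fin n → Fin n → Set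
Adj G u v = adj G u v ≡ true

data Reach {n : ℕ} (G : Graph n) : Fin n → Fin n → Set where
  here  : ∀ {u} → Reach G u u
  step  : ∀ {u v w} → Adj G u v → Reach G v w → Reach G u w

Connected : ∀ {n} → Graph n → Set
Connected G = ∀ u v → Reach G u v

degree : ∀ {n} → Graph n → Fin n → ℕ
degree {n} G u = length (filter (λ v → adj G u v ≟ᵇ true) (allFin n))

edgeCount : ∀ {n} → Graph n → ℕ
edgeCount {n} G = sum (map edgesAbove (allFin n))
  where
  edgesAbove : Fin n → ℕ
  edgesAbove u = length (filter (λ v → adj G u v ≟ᵇ true)
                          (filter (λ v → toℕ u <? toℕ v) (allFin n)))

IsTree : ∀ {n} → Graph n → Set
IsTree {n} G = Connected G × edgeCount G ≡ n ∸ 1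

countDeg : ∀ {n} → Graph n → ℕ → ℕ
countDeg {n} G d = length (filter (λ u → degree G u ≟ d) (allFin n))

-- A k-coloring: a map into Fin k that is proper and onto (a partition of V(G)
-- into k nonempty independent sets).
record Coloring {n : ℕ} (G : Graph n) (k : ℕ) : Set where
  field
    col    : Fin n → Fin k
    proper : ∀ u v → Adj G u v → col u ≢ col v
    onto   : ∀ j → ∃[ u ] col u ≡ j
open Coloring public

SeesColor : ∀ {n k} {G : Graph n} → Coloring G k → Fin n → Fin k → Set
SeesColor {G = G} c u j = ∃[ w ] (Adj G u w × col c w ≡ j)

IsNL : ∀ {n k} {G : Graph n} → Coloring G k → Set
IsNL {k = k} c = ∀ u v → u ≢ v → col c u ≡ col c v →
  ¬ (∀ (j : Fin k) → SeesColor c u j ⇔ SeesColor c v j)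

HasNLColoring : ∀ {n} → Graph n → ℕ → Set
HasNLColoring G k = Σ (Coloring G k) IsNL

ChiNL≡ : ∀ {n} → Graph n → ℕ → Set
ChiNL≡ G k = HasNLColoring G k × (∀ j → j < k → ¬ HasNLColoring G j)

MaxDegree≡ : ∀ {n} → Graph n → ℕ → Set
MaxDegree≡ G d = (∀ u → degree G u ≤ d) × ∃[ u ] degree G u ≡ d

a₁ : ℕ → ℕ
a₁ k = k * (k ∸ 1)

a₂ : ℕ → ℕ
a₂ k = (k * (k ∸ 1) * (k ∸ 2)) / 2

module Submission where

-- Fix a neighbor-locating k-colouring c of T.  Let s(u) be the number of
-- colours seen in N(u), and N₁, N₂ the numbers of vertices with s(u) = 1, 2.
-- (1) A vertex is determined by its colour and the set of colours it sees.
--     For a fixed seen colour j, the vertices seeing only j are located by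
--     their own colour ≠ j, so N₁ ≤ k (k - 1); for fixed colours i ≠ j the
--     vertices seeing exactly {i, j} are located by their colour ∉ {i, j};
--     double counting ordered pairs gives 2 N₂ ≤ k (k - 1)(k - 2) = 2 a₂(k).
-- (2) Give u the weight deg(u) + 2[s(u) = 1] + [s(u) = 2] ≥ 3 (as
--     1 ≤ s(u) ≤ deg(u)).  By the handshake lemma the weights sum to
--     2(n - 1) + 2 N₁ + N₂, hence n + 2 ≤ 2 N₁ + N₂ ≤ 2 a₁ + a₂.
-- (3) At equality all weights are 3, so deg(u) = min(s(u), 3); this yields
--     the degree counts.

open import Defs
open import Data.Nat using (ℕ; _+_; _*_; _∸_; _^_; _≤_; _/_)
open import Data.Product using (_×_)
open import Relation.Binary.PropositionalEquality using (_≡_)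

open import Data.Nat using (zero; suc; z≤n; s≤s; _⊓_; _≟_; _<?_)
open import Data.Nat.Properties
open import Data.Bool using (Bool; true; false; _∧_; _∨_; not)
open import Data.Bool.Properties using (∧-identityʳ; ∧-zeroʳ) renaming (_≟_ to _≟ᵇ_)
open import Data.Fin using (Fin; zero; suc; toℕ)
open import Data.List using (length; filter; tabulate; map; allFin)
import Data.Nat.ListAction as L
open import Relation.Unary using (Pred; Decidable)
open import Level using (0ℓ)
open import Relation.Binary.Definitions using (tri<; tri≈; tri>)
open import Data.Fin.Properties using () renaming (_≟_ to _≟ᶠ_)
import Data.Fin.Properties as Fin
open import Data.Product using (_,_; ∃-syntax; proj₁; proj₂)
open import Data.Empty using (⊥-elim)
open import Function.Bundles using (mk⇔)
open import Data.Sum using (inj₁; inj₂)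
open import Relation.Nullary using (Dec; yes; no; does; _×-dec_)
open import Relation.Nullary.Decidable using (dec-true; dec-false)
open import Relation.Binary.PropositionalEquality using (refl; sym; trans; cong; cong₂; subst; subst₂; _≢_; module ≡-Reasoning)
open import Data.Nat.Tactic.RingSolver using (solve-∀)
open import Data.Nat.Divisibility using (_∣_; ∣m⇒∣m*n; ∣m∣n⇒∣m+n; n∣m*n; divides)
open import Data.Nat.DivMod using (m/n*n≡m; m*n/n≡m)
open import Algebra.Properties.Semiring.Sum +-*-semiring using (sum; ∑-comm; ∑-distrib-+; *-distribʳ-sum; *-distribˡ-sum)
  renaming (sum-cong-≗ to sum-cong)

ind : Bool → ℕ
ind true  = 1
ind false = 0

count : ∀ {n} → (Fin n → Bool) → ℕ
count p = sum (λ x → ind (p x))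

_≡?_ : ∀ {n} → Fin n → Fin n → Bool
x ≡? a = does (x ≟ᶠ a)

count-cong : ∀ {n} {p q : Fin n → Bool} → (∀ x → p x ≡ q x) → count p ≡ count q
count-cong h = sum-cong (λ x → cong ind (h x))

sum-const : ∀ n c → sum {n} (λ _ → c) ≡ n * c
sum-const zero    c = refl
sum-const (suc n) c = cong (c +_) (sum-const n c)

sum-mono : ∀ {n} {f g : Fin n → ℕ} → (∀ x → f x ≤ g x) → sum f ≤ sum g
sum-mono {zero}  _ = z≤n
sum-mono {suc n} h = +-mono-≤ (h zero) (sum-mono (λ x → h (suc x)))

sum-mono-≡ : ∀ {n} {f g : Fin n → ℕ} → (∀ x → f x ≤ g x) → sum f ≡ sum g → ∀ x → f x ≡ g x
sum-mono-≡ {suc n} {f} {g} h e = pointwise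
  where
  rest≤ : sum (λ x → f (suc x)) ≤ sum (λ x → g (suc x))
  rest≤ = sum-mono (λ x → h (suc x))
  head≡ : f zero ≡ g zero
  head≡ with m≤n⇒m<n∨m≡n (h zero)
  ... | inj₂ eq = eq
  ... | inj₁ lt = ⊥-elim (<⇒≢ (+-mono-<-≤ lt rest≤) e)
  pointwise : ∀ x → f x ≡ g x
  pointwise zero    = head≡
  pointwise (suc x) = sum-mono-≡ (λ y → h (suc y)) (+-cancelˡ-≡ (f zero) _ _ (trans e (cong (_+ _) (sym head≡)))) x

≡?-refl : ∀ {n} (a : Fin n) → a ≡? a ≡ true
≡?-refl a = dec-true (a ≟ᶠ a) refl

≡?-≢ : ∀ {n} {x a : Fin n} → x ≢ a → x ≡? a ≡ false
≡?-≢ {x = x} {a} = dec-false (x ≟ᶠ a)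

∧-split : ∀ {a b} → a ∧ b ≡ true → a ≡ true × b ≡ true
∧-split {true} {true} _ = refl , refl

from-does : ∀ {A : Set} (d : Dec A) → does d ≡ true → A
from-does (yes a) _ = a

count-false : ∀ n → count {n} (λ _ → false) ≡ 0
count-false zero    = refl
count-false (suc n) = count-false n

count-true : ∀ n → count {n} (λ _ → true) ≡ n
count-true zero    = refl
count-true (suc n) = cong suc (count-true n)

count-guard : ∀ {n} b (q : Fin n → Bool) → count (λ x → b ∧ q x) ≡ ind b * count q
count-guard true  q = sym (+-identityʳ (count q))
count-guard {n} false q = count-false n

count-singleton : ∀ {n} (a : Fin n) → count (λ j → a ≡? j) ≡ 1
count-singleton {suc n} zero    = cong suc (count-false n)
count-singleton {suc n} (suc a) = count-singleton a

count-remove : ∀ {n} (p : Fin n → Bool) b → p b ≡ true →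
  count p ≡ suc (count (λ x → p x ∧ not (x ≡? b)))
count-remove {suc n} p zero pb rewrite pb =
  cong suc (count-cong (λ x → sym (∧-identityʳ (p (suc x)))))
count-remove {suc n} p (suc b) pb
  rewrite ∧-identityʳ (p zero) | count-remove (λ x → p (suc x)) b pb =
  +-suc (ind (p zero)) _

count-zero : ∀ {n} (p : Fin n → Bool) → count p ≡ 0 → ∀ x → p x ≡ false
count-zero p e x with p x in px
... | false = refl
... | true with () ← trans (sym (count-remove p x px)) e

count-witness : ∀ {n} (p : Fin n → Bool) → 1 ≤ count p → ∃[ x ] p x ≡ true
count-witness {suc n} p le with p zero in p0
... | true  = zero , p0
... | false with count-witness (λ x → p (suc x)) le
...   | x , px = suc x , px

count-others : ∀ n (i : Fin n) → count (λ j → not (j ≡? i)) ≡ n ∸ 1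
count-others n i = cong (_∸ 1) (sym (trans (sym (count-true n)) (count-remove (λ _ → true) i refl)))

count-others₂ : ∀ n (i j : Fin n) → i ≢ j → count (λ c → not (c ≡? i) ∧ not (c ≡? j)) ≡ n ∸ 2
count-others₂ n i j i≢j = begin
  count (λ c → not (c ≡? i) ∧ not (c ≡? j))        ≡⟨ cong (_∸ 1) (count-remove (λ c → not (c ≡? i)) j j∉) ⟨
  count (λ c → not (c ≡? i)) ∸ 1                    ≡⟨ cong (_∸ 1) (count-others n i) ⟩
  n ∸ 1 ∸ 1                                         ≡⟨ ∸-+-assoc n 1 1 ⟩
  n ∸ 2                                             ∎
  where
  open ≡-Reasoning
  j∉ : not (j ≡? i) ≡ true
  j∉ = cong not (≡?-≢ (λ j≡i → i≢j (sym j≡i)))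

count-one : ∀ {n} (p : Fin n → Bool) {a} → count p ≡ 1 → p a ≡ true → ∀ x → p x ≡ x ≡? a
count-one p {a} size pa x with x ≟ᶠ a
... | yes refl = pa
... | no  x≢a  = trans (sym (∧-identityʳ (p x)))
                   (subst (λ b → p x ∧ not b ≡ false) (≡?-≢ x≢a)
                     (count-zero _ (suc-injective (trans (sym (count-remove p a pa)) size)) x))

count-two : ∀ {n} (p : Fin n → Bool) {a b} → count p ≡ 2 → p a ≡ true → p b ≡ true → a ≢ b →
  ∀ x → p x ≡ (x ≡? a ∨ x ≡? b)
count-two p {a} {b} size pa pb a≢b x with x ≟ᶠ a
... | yes refl = pa
... | no  x≢a  = trans (sym (∧-identityʳ (p x)))
                   (subst (λ c → p x ∧ not c ≡ x ≡? b) (≡?-≢ x≢a) (count-one q q-size qb x))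
  where
  q : _ → Bool
  q y = p y ∧ not (y ≡? a)
  q-size : count q ≡ 1
  q-size = suc-injective (trans (sym (count-remove p a pa)) size)
  qb : q b ≡ true
  qb = subst (λ c → p b ∧ not c ≡ true) (sym (≡?-≢ (λ b≡a → a≢b (sym b≡a)))) (trans (∧-identityʳ (p b)) pb)

ind-≤-count : ∀ {n} b (q : Fin n → Bool) → (b ≡ true → ∃[ x ] q x ≡ true) → ind b ≤ count q
ind-≤-count false q _ = z≤n
ind-≤-count true  q w with w refl
... | x , qx rewrite count-remove q x qx = s≤s z≤n

count-inject : ∀ {n m} (p : Fin n → Bool) (q : Fin m → Bool) (f : Fin n → Fin m) →
  (∀ x → p x ≡ true → q (f x) ≡ true) →
  (∀ x y → p x ≡ true → p y ≡ true → f x ≡ f y → x ≡ y) → count p ≤ count q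
count-inject {zero}  p q f maps inj = z≤n
count-inject {suc n} p q f maps inj with p zero in p0
... | false = count-inject (λ x → p (suc x)) q (λ x → f (suc x)) (λ x → maps (suc x))
                (λ x y px py e → Fin.suc-injective (inj (suc x) (suc y) px py e))
... | true  rewrite count-remove q (f zero) (maps zero p0) =
  s≤s (count-inject (λ x → p (suc x)) (λ y → q y ∧ not (y ≡? f zero)) (λ x → f (suc x)) maps-tail
        (λ x y px py e → Fin.suc-injective (inj (suc x) (suc y) px py e)))
  where
  maps-tail : ∀ x → p (suc x) ≡ true → q (f (suc x)) ∧ not (f (suc x) ≡? f zero) ≡ true
  maps-tail x px rewrite ≡?-≢ (λ e → Fin.0≢1+n (sym (inj (suc x) zero px p0 e))) = trans (∧-identityʳ _) (maps (suc x) px)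

count-partition : ∀ {n m} (p : Fin n → Bool) (g : Fin n → Fin m) →
  count p ≡ sum (λ j → count (λ w → p w ∧ g w ≡? j))
count-partition {n} {m} p g = sym (trans (∑-comm (λ j w → ind (p w ∧ g w ≡? j))) (sum-cong fibre))
  where
  fibre : ∀ w → count (λ j → p w ∧ g w ≡? j) ≡ ind (p w)
  fibre w = trans (count-guard (p w) (λ j → g w ≡? j))
                  (trans (cong (ind (p w) *_) (count-singleton (g w))) (*-identityʳ (ind (p w))))

∑-count-swap : ∀ {n m} (p : Fin n → Bool) (q : Fin n → Fin m → Bool) →
  sum (λ j → count (λ u → p u ∧ q u j)) ≡ sum (λ u → ind (p u) * count (q u))
∑-count-swap p q = trans (∑-comm (λ j u → ind (p u ∧ q u j))) (sum-cong (λ u → count-guard (p u) (q u)))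

sum-guarded-const : ∀ {n} (p : Fin n → Bool) (f : Fin n → ℕ) c → (∀ u → p u ≡ true → f u ≡ c) →
  sum (λ u → ind (p u) * f u) ≡ count p * c
sum-guarded-const p f c const = trans (sum-cong pointwise) (sym (*-distribʳ-sum c (λ u → ind (p u))))
  where
  pointwise : ∀ u → ind (p u) * f u ≡ ind (p u) * c
  pointwise u with p u in pu
  ... | true  = cong (_+ 0) (const u pu)
  ... | false = refl

ordered-pairs : ∀ {n} (S : Fin n → Bool) →
  sum (λ i → count (λ j → S i ∧ (S j ∧ not (j ≡? i)))) ≡ count S * (count S ∸ 1)
ordered-pairs {n} S = begin
  sum (λ i → count (λ j → S i ∧ (S j ∧ not (j ≡? i))))  ≡⟨ sum-cong (λ i → count-guard {n} (S i) _) ⟩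
  sum (λ i → ind (S i) * count (λ j → S j ∧ not (j ≡? i))) ≡⟨ sum-guarded-const S _ _ others ⟩
  count S * (count S ∸ 1)                                 ∎
  where
  open ≡-Reasoning
  others : ∀ i → S i ≡ true → count (λ j → S j ∧ not (j ≡? i)) ≡ count S ∸ 1
  others i Si = cong (_∸ 1) (sym (count-remove S i Si))

length-filter : ∀ {A : Set} {P : Pred A 0ℓ} (P? : Decidable P) {n} (f : Fin n → A) →
  length (filter P? (tabulate f)) ≡ count (λ i → does (P? (f i)))
length-filter P? {zero}  f = refl
length-filter P? {suc n} f with does (P? (f zero))
... | true  = cong suc (length-filter P? (λ x → f (suc x)))
... | false = length-filter P? (λ x → f (suc x))

length-filter₂ : ∀ {A : Set} {P Q : Pred A 0ℓ} (P? : Decidable P) (Q? : Decidable Q) {n} (f : Fin n → A) →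
  length (filter P? (filter Q? (tabulate f))) ≡ count (λ i → does (Q? (f i)) ∧ does (P? (f i)))
length-filter₂ P? Q? {zero}  f = refl
length-filter₂ P? Q? {suc n} f with does (Q? (f zero))
... | false = length-filter₂ P? Q? (λ x → f (suc x))
... | true  with does (P? (f zero))
...   | true  = cong suc (length-filter₂ P? Q? (λ x → f (suc x)))
...   | false = length-filter₂ P? Q? (λ x → f (suc x))

listSum-tabulate : ∀ {A : Set} {n} (f : A → ℕ) (g : Fin n → A) → L.sum (map f (tabulate g)) ≡ sum (λ x → f (g x))
listSum-tabulate {n = zero}  f g = refl
listSum-tabulate {n = suc n} f g = cong (f (g zero) +_) (listSum-tabulate f (λ x → g (suc x)))

does-≟true : ∀ b → does (b ≟ᵇ true) ≡ b
does-≟true true  = refl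
does-≟true false = refl

deg : ∀ {n} → Graph n → Fin n → ℕ
deg T u = count (adj T u)

degree-count : ∀ {n} (T : Graph n) u → degree T u ≡ deg T u
degree-count T u = trans (length-filter (λ v → adj T u v ≟ᵇ true) (λ v → v))
                         (count-cong (λ v → does-≟true (adj T u v)))

countDeg-count : ∀ {n} (T : Graph n) d → countDeg T d ≡ count (λ u → does (deg T u ≟ d))
countDeg-count T d = trans (length-filter (λ u → degree T u ≟ d) (λ u → u))
                           (count-cong (λ u → cong (λ e → does (e ≟ d)) (degree-count T u)))

module _ {n} (T : Graph n) where
  private
    below : Fin n → Fin n → Bool
    below u v = does (toℕ u <? toℕ v)

    up down : Fin n → ℕ
    up   u = count (λ v → below u v ∧ adj T u v)
    down u = count (λ v → below v u ∧ adj T u v)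

    edgeCount-count : edgeCount T ≡ sum up
    edgeCount-count = trans (listSum-tabulate {n = n} _ (λ u → u)) (sum-cong (λ u →
      trans (length-filter₂ (λ v → adj T u v ≟ᵇ true) (λ v → toℕ u <? toℕ v) (λ v → v))
            (count-cong (λ v → cong (below u v ∧_) (does-≟true (adj T u v))))))

    adj-split : ∀ u v → ind (adj T u v) ≡ ind (below u v ∧ adj T u v) + ind (below v u ∧ adj T u v)
    adj-split u v with <-cmp (toℕ u) (toℕ v)
    ... | tri< u<v _ _ rewrite dec-true (toℕ u <? toℕ v) u<v | dec-false (toℕ v <? toℕ u) (<-asym u<v) =
      sym (+-identityʳ _)
    ... | tri> _ _ v<u rewrite dec-true (toℕ v <? toℕ u) v<u | dec-false (toℕ u <? toℕ v) (<-asym v<u) = refl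
    ... | tri≈ _ u≡v _ rewrite dec-false (toℕ v <? toℕ u) (<-irrefl (sym u≡v))
                             | dec-false (toℕ u <? toℕ v) (<-irrefl u≡v) =
      cong ind (trans (cong (adj T u) (sym (Fin.toℕ-injective u≡v))) (irreflex T u))

    down≡up : sum down ≡ sum up
    down≡up = trans (∑-comm (λ u v → ind (below v u ∧ adj T u v)))
                    (sum-cong (λ v → count-cong (λ u → cong (below v u ∧_) (symmetric T u v))))

  handshake : sum (deg T) ≡ 2 * edgeCount T
  handshake = begin
    sum (deg T)                 ≡⟨ sum-cong (λ u → trans (sum-cong (adj-split u))
                                                         (∑-distrib-+ (λ v → ind (below u v ∧ adj T u v)) _)) ⟩
    sum (λ u → up u + down u)   ≡⟨ ∑-distrib-+ up down ⟩
    sum up + sum down           ≡⟨ cong (sum up +_) (trans down≡up (sym (+-identityʳ (sum up)))) ⟩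
    2 * sum up                  ≡⟨ cong (2 *_) edgeCount-count ⟨
    2 * edgeCount T             ∎
    where open ≡-Reasoning

has-neighbour : ∀ {n} (T : Graph n) → Connected T → 2 ≤ n → ∀ u → ∃[ w ] Adj T u w
has-neighbour T connected (s≤s (s≤s _)) u = first-step (another u) (connected u (other u))
  where
  other : ∀ {m} → Fin (suc (suc m)) → Fin (suc (suc m))
  other zero    = suc zero
  other (suc _) = zero
  another : ∀ {m} (v : Fin (suc (suc m))) → v ≢ other v
  another zero    ()
  another (suc _) ()
  first-step : ∀ {v w} → v ≢ w → Reach T v w → ∃[ x ] Adj T v x
  first-step v≢w here         = ⊥-elim (v≢w refl)
  first-step _   (step a _)   = _ , a

module Colouring {n k} (T : Graph n) (c : Coloring T k) where

  sees? : ∀ u j → Dec (SeesColor c u j)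
  sees? u j = Fin.any? (λ w → (adj T u w ≟ᵇ true) ×-dec (col c w ≟ᶠ j))

  sees : Fin n → Fin k → Bool
  sees u j = does (sees? u j)

  colours : Fin n → ℕ
  colours u = count (sees u)

  sees-neighbour : ∀ {u w} → Adj T u w → sees u (col c w) ≡ true
  sees-neighbour {u} {w} a = dec-true (sees? u (col c w)) (w , a , refl)

  unseen-own : ∀ {u j} → sees u j ≡ true → col c u ≢ j
  unseen-own {u} {j} s refl with from-does (sees? u j) s
  ... | w , a , e = proper c u w a (sym e)

  colours≥1 : ∀ {u w} → Adj T u w → 1 ≤ colours u
  colours≥1 {u} {w} a = ind-≤-count true (sees u) (λ _ → col c w , sees-neighbour a)

  -- each colour seen from u is the colour of some neighbour of u
  colours≤deg : ∀ u → colours u ≤ deg T u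
  colours≤deg u = subst (colours u ≤_) (sym (count-partition (adj T u) (col c)))
                    (sum-mono (λ j → ind-≤-count (sees u j) _ (witness j)))
    where
    witness : ∀ j → sees u j ≡ true → ∃[ w ] adj T u w ∧ col c w ≡? j ≡ true
    witness j s with from-does (sees? u j) s
    ... | w , a , refl = w , subst (λ b → b ∧ col c w ≡? col c w ≡ true) (sym a) (≡?-refl (col c w))

  module Locating (nl : IsNL c) where

    locate : ∀ {u v} → col c u ≡ col c v → (∀ j → sees u j ≡ sees v j) → u ≡ v
    locate {u} {v} same-col same-seen with u ≟ᶠ v
    ... | yes u≡v = u≡v
    ... | no  u≢v = ⊥-elim (nl u v u≢v same-col (λ j → mk⇔ (transfer u v j (same-seen j))
                                                          (transfer v u j (sym (same-seen j)))))
      where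
      transfer : ∀ x y j → sees x j ≡ sees y j → SeesColor c x j → SeesColor c y j
      transfer x y j e s = from-does (sees? y j) (trans (sym e) (dec-true (sees? x j) s))

    oneColour twoColours : Fin n → Bool
    oneColour  u = does (colours u ≟ 1)
    twoColours u = does (colours u ≟ 2)

    -- For a fixed colour j, the vertices seeing only j are located by their
    -- own colour, which differs from j.
    one-colour-fibre : ∀ j → count (λ u → oneColour u ∧ sees u j) ≤ count (λ i → not (i ≡? j))
    one-colour-fibre j = count-inject _ _ (col c) maps inj
      where
      seen-set : ∀ u → oneColour u ∧ sees u j ≡ true → ∀ i → sees u i ≡ i ≡? j
      seen-set u h = let h₁ , h₂ = ∧-split h in
        count-one (sees u) (from-does (colours u ≟ 1) h₁) h₂
      maps : ∀ u → oneColour u ∧ sees u j ≡ true → not (col c u ≡? j) ≡ true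
      maps u h = cong not (≡?-≢ (unseen-own (proj₂ (∧-split h))))
      inj : ∀ x y → _ → _ → col c x ≡ col c y → x ≡ y
      inj x y hx hy e = locate e (λ i → trans (seen-set x hx i) (sym (seen-set y hy i)))

    one-colour-bound : count oneColour ≤ k * (k ∸ 1)
    one-colour-bound = begin
      count oneColour
        ≡⟨ *-identityʳ _ ⟨
      count oneColour * 1
        ≡⟨ sum-guarded-const oneColour colours 1 (λ u → from-does (colours u ≟ 1)) ⟨
      sum (λ u → ind (oneColour u) * colours u)
        ≡⟨ ∑-count-swap oneColour sees ⟨
      sum {k} (λ j → count (λ u → oneColour u ∧ sees u j))
        ≤⟨ sum-mono one-colour-fibre ⟩
      sum {k} (λ j → count {k} (λ i → not (i ≡? j)))
        ≡⟨ sum-cong (count-others k) ⟩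
      sum {k} (λ _ → k ∸ 1)
        ≡⟨ sum-const k (k ∸ 1) ⟩
      k * (k ∸ 1) ∎
      where open ≤-Reasoning

    seesPair : Fin n → Fin k → Fin k → Bool
    seesPair u i j = sees u i ∧ (sees u j ∧ not (j ≡? i))

    -- For fixed colours i ≠ j, the vertices seeing exactly {i, j} are located
    -- by their own colour, which avoids i and j.
    pair-fibre : ∀ {i j} → i ≢ j → count (λ u → twoColours u ∧ (sees u i ∧ sees u j)) ≤ k ∸ 2
    pair-fibre {i} {j} i≢j = subst (count (λ u → twoColours u ∧ (sees u i ∧ sees u j)) ≤_) (count-others₂ k i j i≢j)
      (count-inject (λ u → twoColours u ∧ (sees u i ∧ sees u j)) (λ x → not (x ≡? i) ∧ not (x ≡? j)) (col c) maps inj)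
      where
      seen-set : ∀ u → twoColours u ∧ (sees u i ∧ sees u j) ≡ true → ∀ x → sees u x ≡ (x ≡? i ∨ x ≡? j)
      seen-set u h = let two , h′ = ∧-split {twoColours u} h ; si , sj = ∧-split {sees u i} h′ in
        count-two (sees u) (from-does (colours u ≟ 2) two) si sj i≢j
      maps : ∀ u → twoColours u ∧ (sees u i ∧ sees u j) ≡ true → not (col c u ≡? i) ∧ not (col c u ≡? j) ≡ true
      maps u h = let _ , h′ = ∧-split {twoColours u} h ; si , sj = ∧-split {sees u i} h′ in
        cong₂ (λ a b → not a ∧ not b) (≡?-≢ (unseen-own si)) (≡?-≢ (unseen-own sj))
      inj : ∀ x y → _ → _ → col c x ≡ col c y → x ≡ y
      inj x y hx hy e = locate e (λ z → trans (seen-set x hx z) (sym (seen-set y hy z)))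

    -- the same bound for ordered pairs, where the pairs with i = j contribute 0
    two-colour-fibre : ∀ i j → count (λ u → twoColours u ∧ seesPair u i j) ≤ ind (not (j ≡? i)) * (k ∸ 2)
    two-colour-fibre i j with j ≟ᶠ i
    ... | yes refl = ≤-reflexive (trans (count-cong no-pair) (count-false n))
      where
      no-pair : ∀ u → twoColours u ∧ (sees u j ∧ (sees u j ∧ false)) ≡ false
      no-pair u rewrite ∧-zeroʳ (sees u j) | ∧-zeroʳ (sees u j) = ∧-zeroʳ (twoColours u)
    ... | no j≢i = subst₂ _≤_ (count-cong drop-true) (sym (+-identityʳ (k ∸ 2)))
                          (pair-fibre (λ i≡j → j≢i (sym i≡j)))
      where
      drop-true : ∀ u → twoColours u ∧ (sees u i ∧ sees u j) ≡ twoColours u ∧ (sees u i ∧ (sees u j ∧ true))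
      drop-true u = cong (λ b → twoColours u ∧ (sees u i ∧ b)) (sym (∧-identityʳ (sees u j)))

    -- a vertex seeing exactly two colours is counted once for each ordering (i, j)
    two-colour-bound : count twoColours * 2 ≤ k * ((k ∸ 1) * (k ∸ 2))
    two-colour-bound = begin
      count twoColours * 2
        ≡⟨ sum-guarded-const twoColours pairs 2 two-pairs ⟨
      sum (λ u → ind (twoColours u) * pairs u)
        ≡⟨ sum-cong (λ u → *-distribˡ-sum (ind (twoColours u)) (λ i → count (seesPair u i))) ⟩
      sum (λ u → sum (λ i → ind (twoColours u) * count (seesPair u i)))
        ≡⟨ ∑-comm (λ u i → ind (twoColours u) * count (seesPair u i)) ⟩
      sum {k} (λ i → sum (λ u → ind (twoColours u) * count (seesPair u i)))
        ≡⟨ sum-cong (λ i → ∑-count-swap twoColours (λ u → seesPair u i)) ⟨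
      sum {k} (λ i → sum {k} (λ j → count (λ u → twoColours u ∧ seesPair u i j)))
        ≤⟨ sum-mono (λ i → sum-mono (two-colour-fibre i)) ⟩
      sum {k} (λ i → sum {k} (λ j → ind (not (j ≡? i)) * (k ∸ 2)))
        ≡⟨ sum-cong (λ i → *-distribʳ-sum {k} (k ∸ 2) (λ j → ind (not (j ≡? i)))) ⟨
      sum {k} (λ i → count {k} (λ j → not (j ≡? i)) * (k ∸ 2))
        ≡⟨ sum-cong (λ i → cong (_* (k ∸ 2)) (count-others k i)) ⟩
      sum {k} (λ _ → (k ∸ 1) * (k ∸ 2))
        ≡⟨ sum-const k _ ⟩
      k * ((k ∸ 1) * (k ∸ 2)) ∎
      where
      open ≤-Reasoning
      pairs : Fin n → ℕ
      pairs u = sum (λ i → count (seesPair u i))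
      two-pairs : ∀ u → twoColours u ≡ true → pairs u ≡ 2
      two-pairs u h = trans (ordered-pairs (sees u)) (cong (λ m → m * (m ∸ 1)) (from-does (colours u ≟ 2) h))

weight : ℕ → ℕ → ℕ
weight d s = d + 2 * ind (does (s ≟ 1)) + ind (does (s ≟ 2))

weight≥3 : ∀ d s → 1 ≤ s → s ≤ d → 3 ≤ weight d s
weight≥3 d 1                   _ 1≤d = +-mono-≤ (+-monoˡ-≤ 2 1≤d) z≤n
weight≥3 d 2                   _ 2≤d = +-monoˡ-≤ 1 (≤-trans 2≤d (m≤m+n d 0))
weight≥3 d (suc (suc (suc t))) _ s≤d = ≤-trans (≤-trans (s≤s (s≤s (s≤s z≤n))) s≤d) (≤-trans (m≤m+n d 0) (m≤m+n (d + 0) 0))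

weight≡3 : ∀ d s → 1 ≤ s → weight d s ≡ 3 → d ≡ s ⊓ 3
weight≡3 d 1                   _ e = +-cancelʳ-≡ 2 d 1 (trans (sym (+-identityʳ (d + 2))) e)
weight≡3 d 2                   _ e = +-cancelʳ-≡ 0 d 2 (+-cancelʳ-≡ 1 (d + 0) 2 e)
weight≡3 d (suc (suc (suc t))) _ e rewrite ⊓-zeroʳ t = +-cancelʳ-≡ 0 d 3 (trans (sym (+-identityʳ (d + 0))) e)

capped-1 : ∀ s → does (s ⊓ 3 ≟ 1) ≡ does (s ≟ 1)
capped-1 0                   = refl
capped-1 1                   = refl
capped-1 2                   = refl
capped-1 (suc (suc (suc t))) = refl

capped-2 : ∀ s → does (s ⊓ 3 ≟ 2) ≡ does (s ≟ 2)
capped-2 0                   = refl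
capped-2 1                   = refl
capped-2 2                   = refl
capped-2 (suc (suc (suc t))) = refl

one-of-three : ∀ s → 1 ≤ s → ind (does (s ≟ 1)) + ind (does (s ≟ 2)) + ind (does (s ⊓ 3 ≟ 3)) ≡ 1
one-of-three 1                   _ = refl
one-of-three 2                   _ = refl
one-of-three (suc (suc (suc t))) _ rewrite ⊓-zeroʳ t = refl

weights-excess : ∀ n X → 1 ≤ n → n * 3 ≤ 2 * (n ∸ 1) + X → n + 2 ≤ X
weights-excess (suc m) X _ le = +-cancelˡ-≤ (2 * m) (suc m + 2) X (subst (_≤ 2 * m + X) (rearrange m) le)
  where
  rearrange : ∀ m → suc m * 3 ≡ 2 * m + (suc m + 2)
  rearrange = solve-∀

weights-tight : ∀ n → 1 ≤ n → 2 * (n ∸ 1) + (n + 2) ≡ n * 3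
weights-tight (suc m) _ = rearrange m
  where
  rearrange : ∀ m → 2 * m + (suc m + 2) ≡ suc m * 3
  rearrange = solve-∀

three-classes : ∀ {n a b c} → n ≡ a + b + c → 2 * a + b ≡ n + 2 → c + 2 ≡ a
three-classes {a = a} {b} {c} refl e = +-cancelʳ-≡ (a + b) (c + 2) a (trans (rearrange₁ a b c) (trans (sym e) (rearrange₂ a b)))
  where
  rearrange₁ : ∀ a b c → (c + 2) + (a + b) ≡ a + b + c + 2
  rearrange₁ = solve-∀
  rearrange₂ : ∀ a b → 2 * a + b ≡ a + (a + b)
  rearrange₂ = solve-∀

tight-pair : ∀ {a A b B} → a ≤ A → b ≤ B → 2 * a + b ≡ 2 * A + B → a ≡ A × b ≡ B
tight-pair {a} {A} {b} {B} a≤A b≤B e = a≡A , +-cancelˡ-≡ (2 * A) b B (trans (cong (λ x → 2 * x + b) (sym a≡A)) e)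
  where
  a≡A : a ≡ A
  a≡A = *-cancelˡ-≡ a A 2 (+-cancelʳ-≡ B (2 * a) (2 * A) (≤-antisym
          (+-monoˡ-≤ B (*-monoʳ-≤ 2 a≤A))
          (subst (_≤ 2 * a + B) e (+-monoʳ-≤ (2 * a) b≤B))))

module WeightCount {n k} (T : Graph n) (c : Coloring T k) (nl : IsNL c)
                   (edges : edgeCount T ≡ n ∸ 1) (neighbour : ∀ u → ∃[ w ] Adj T u w) where
  open Colouring T c
  open Locating nl

  N₁ N₂ : ℕ
  N₁ = count oneColour
  N₂ = count twoColours

  sees-some : ∀ u → 1 ≤ colours u
  sees-some u = colours≥1 (proj₂ (neighbour u))

  vertexWeight : Fin n → ℕ
  vertexWeight u = weight (deg T u) (colours u)

  weight-sum : sum vertexWeight ≡ 2 * (n ∸ 1) + (2 * N₁ + N₂)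
  weight-sum = begin
    sum vertexWeight
      ≡⟨ ∑-distrib-+ (λ u → deg T u + 2 * ind (oneColour u)) (λ u → ind (twoColours u)) ⟩
    sum (λ u → deg T u + 2 * ind (oneColour u)) + N₂
      ≡⟨ cong (_+ N₂) (∑-distrib-+ (deg T) (λ u → 2 * ind (oneColour u))) ⟩
    sum (deg T) + sum (λ u → 2 * ind (oneColour u)) + N₂
      ≡⟨ cong₂ (λ x y → x + y + N₂) (trans (handshake T) (cong (2 *_) edges))
                                     (sym (*-distribˡ-sum 2 (λ u → ind (oneColour u)))) ⟩
    2 * (n ∸ 1) + 2 * N₁ + N₂
      ≡⟨ +-assoc (2 * (n ∸ 1)) (2 * N₁) N₂ ⟩
    2 * (n ∸ 1) + (2 * N₁ + N₂) ∎
    where open ≡-Reasoning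

  weight≥3-everywhere : ∀ u → 3 ≤ vertexWeight u
  weight≥3-everywhere u = weight≥3 (deg T u) (colours u) (sees-some u) (colours≤deg u)

  vertex-bound : 1 ≤ n → n + 2 ≤ 2 * N₁ + N₂
  vertex-bound 1≤n = weights-excess n (2 * N₁ + N₂) 1≤n (begin
    n * 3                        ≡⟨ sum-const n 3 ⟨
    sum {n} (λ _ → 3)            ≤⟨ sum-mono weight≥3-everywhere ⟩
    sum vertexWeight             ≡⟨ weight-sum ⟩
    2 * (n ∸ 1) + (2 * N₁ + N₂)  ∎)
    where open ≤-Reasoning

  -- If the bound n + 2 ≤ 2 N₁ + N₂ is attained, every vertex has weight exactly
  -- 3, so its degree is determined by the number of colours it sees.
  module Tight (1≤n : 1 ≤ n) (tight : 2 * N₁ + N₂ ≡ n + 2) where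

    degree-profile : ∀ u → deg T u ≡ colours u ⊓ 3
    degree-profile u = weight≡3 (deg T u) (colours u) (sees-some u)
                         (sym (sum-mono-≡ weight≥3-everywhere all-three u))
      where
      open ≡-Reasoning
      all-three : sum {n} (λ _ → 3) ≡ sum vertexWeight
      all-three = begin
        sum {n} (λ _ → 3)              ≡⟨ sum-const n 3 ⟩
        n * 3                          ≡⟨ weights-tight n 1≤n ⟨
        2 * (n ∸ 1) + (n + 2)          ≡⟨ cong (2 * (n ∸ 1) +_) tight ⟨
        2 * (n ∸ 1) + (2 * N₁ + N₂)    ≡⟨ weight-sum ⟨
        sum vertexWeight               ∎

    countDeg-profile : ∀ d → countDeg T d ≡ count (λ u → does (colours u ⊓ 3 ≟ d))
    countDeg-profile d = trans (countDeg-count T d)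
                               (count-cong (λ u → cong (λ e → does (e ≟ d)) (degree-profile u)))

    leaves : countDeg T 1 ≡ N₁
    leaves = trans (countDeg-profile 1) (count-cong (λ u → capped-1 (colours u)))

    degree-two : countDeg T 2 ≡ N₂
    degree-two = trans (countDeg-profile 2) (count-cong (λ u → capped-2 (colours u)))

    -- every vertex has degree 1, 2 or 3
    vertex-classes : n ≡ N₁ + N₂ + countDeg T 3
    vertex-classes = begin
      n
        ≡⟨ count-true n ⟨
      count {n} (λ _ → true)
        ≡⟨ sum-cong (λ u → sym (one-of-three (colours u) (sees-some u))) ⟩
      sum (λ u → ind (oneColour u) + ind (twoColours u) + ind (does (colours u ⊓ 3 ≟ 3)))
        ≡⟨ ∑-distrib-+ (λ u → ind (oneColour u) + ind (twoColours u)) _ ⟩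
      sum (λ u → ind (oneColour u) + ind (twoColours u)) + count (λ u → does (colours u ⊓ 3 ≟ 3))
        ≡⟨ cong₂ _+_ (∑-distrib-+ (λ u → ind (oneColour u)) _) (sym (countDeg-profile 3)) ⟩
      N₁ + N₂ + countDeg T 3 ∎
      where open ≡-Reasoning

    degree-three : countDeg T 3 + 2 ≡ N₁
    degree-three = three-classes vertex-classes tight

    max-degree : ∀ u → degree T u ≤ 3
    max-degree u = subst (_≤ 3) (sym (trans (degree-count T u) (degree-profile u))) (m⊓n≤n (colours u) 3)

    degree-three-exists : 3 ≤ N₁ → ∃[ u ] degree T u ≡ 3
    degree-three-exists 3≤N₁ with count-witness (λ u → does (deg T u ≟ 3)) some-three
      where
      some-three : 1 ≤ count (λ u → does (deg T u ≟ 3))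
      some-three = subst (1 ≤_) (countDeg-count T 3) (+-cancelʳ-≤ 2 1 _ (subst (3 ≤_) (sym degree-three) 3≤N₁))
    ... | u , is-three = u , trans (degree-count T u) (from-does (deg T u ≟ 3) is-three)

even-pairs : ∀ k → 2 ∣ k * (k ∸ 1)
even-pairs zero = divides 0 refl
even-pairs (suc zero) = divides 0 refl
even-pairs (suc (suc m)) = subst (2 ∣_) (pairs-step m) (∣m∣n⇒∣m+n (even-pairs (suc m)) (n∣m*n (suc m)))
  where
  pairs-step : ∀ m → suc m * m + suc m * 2 ≡ suc (suc m) * suc m
  pairs-step = solve-∀

a₂-double : ∀ k → a₂ k * 2 ≡ k * ((k ∸ 1) * (k ∸ 2))
a₂-double k = trans (m/n*n≡m (∣m⇒∣m*n (k ∸ 2) (even-pairs k))) (*-assoc k (k ∸ 1) (k ∸ 2))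

closed-form : ∀ m → let k = 3 + m in 2 * a₁ k + a₂ k ∸ 2 ≡ (k ^ 3 + k ^ 2 ∸ 2 * k ∸ 4) / 2
closed-form m = sym (begin
  (k ^ 3 + k ^ 2 ∸ 2 * k ∸ 4) / 2         ≡⟨ cong (λ x → (x ∸ 2 * k ∸ 4) / 2) cube ⟩
  (A * 2 + 2 * k ∸ 2 * k ∸ 4) / 2         ≡⟨ cong (λ x → (x ∸ 4) / 2) (m+n∸n≡m (A * 2) (2 * k)) ⟩
  (A * 2 ∸ 4) / 2                         ≡⟨ cong (_/ 2) (*-distribʳ-∸ 2 A 2) ⟨
  (A ∸ 2) * 2 / 2                         ≡⟨ m*n/n≡m (A ∸ 2) 2 ⟩
  A ∸ 2                                   ∎)
  where
  open ≡-Reasoning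
  k = 3 + m
  A = 2 * a₁ k + a₂ k
  poly : ∀ m → (3 + m) * ((3 + m) * ((3 + m) * 1)) + (3 + m) * ((3 + m) * 1) ≡ 2 * ((3 + m) * (2 + m)) * 2 + (3 + m) * ((2 + m) * (1 + m)) + 2 * (3 + m)
  poly = solve-∀
  cube : k ^ 3 + k ^ 2 ≡ A * 2 + 2 * k
  cube = trans (poly m) (cong (_+ 2 * k) (trans (cong (2 * a₁ k * 2 +_) (sym (a₂-double k))) (sym (*-distribʳ-+ 2 (2 * a₁ k) (a₂ k)))))

-- In the extremal case there are a₁(k) - 2 ≥ 1 vertices of degree 3.
a₁≥3 : ∀ m → 3 ≤ a₁ (3 + m)
a₁≥3 m = *-mono-≤ {3} {3 + m} {1} {2 + m} (+-monoʳ-≤ 3 z≤n) (s≤s z≤n)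

-- The bound only uses a neighbor-locating k-colouring of T; the counts
-- N₁ ≤ a₁ and N₂ ≤ a₂ must both be tight when n attains it.
theorem25 : ∀ (n : ℕ) (T : Graph n) (k : ℕ) →
    2 ≤ n → IsTree T → ChiNL≡ T k → 3 ≤ k →
    (n ≤ 2 * a₁ k + a₂ k ∸ 2)
    × (2 * a₁ k + a₂ k ∸ 2 ≡ (k ^ 3 + k ^ 2 ∸ 2 * k ∸ 4) / 2)
    × (n ≡ 2 * a₁ k + a₂ k ∸ 2 →
        MaxDegree≡ T 3
        × countDeg T 1 ≡ a₁ k
        × countDeg T 2 ≡ a₂ k
        × countDeg T 3 ≡ a₁ k ∸ 2)
theorem25 n T k@(suc (suc (suc m))) 2≤n (connected , edges) ((c , nl) , _) (s≤s (s≤s (s≤s _))) =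
  m+n≤o⇒m≤o∸n n n+2≤bound , closed-form m , extremal
  where
  open Colouring T c
  open Locating nl
  open WeightCount T c nl edges (has-neighbour T connected 2≤n)
  1≤n : 1 ≤ n
  1≤n = ≤-trans (s≤s z≤n) 2≤n
  N₁≤a₁ : N₁ ≤ a₁ k
  N₁≤a₁ = one-colour-bound
  N₂≤a₂ : N₂ ≤ a₂ k
  N₂≤a₂ = *-cancelʳ-≤ N₂ (a₂ k) 2 (subst (N₂ * 2 ≤_) (sym (a₂-double k)) two-colour-bound)
  counts≤ : 2 * N₁ + N₂ ≤ 2 * a₁ k + a₂ k
  counts≤ = +-mono-≤ (*-monoʳ-≤ 2 N₁≤a₁) N₂≤a₂
  n+2≤bound : n + 2 ≤ 2 * a₁ k + a₂ k
  n+2≤bound = ≤-trans (vertex-bound 1≤n) counts≤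
  extremal : n ≡ 2 * a₁ k + a₂ k ∸ 2 →
    MaxDegree≡ T 3 × countDeg T 1 ≡ a₁ k × countDeg T 2 ≡ a₂ k × countDeg T 3 ≡ a₁ k ∸ 2
  extremal n≡ = (max-degree , degree-three-exists (subst (3 ≤_) (sym N₁≡a₁) (a₁≥3 m))) ,
                trans leaves N₁≡a₁ , trans degree-two N₂≡a₂ ,
                trans (sym (m+n∸n≡m (countDeg T 3) 2)) (cong (_∸ 2) (trans degree-three N₁≡a₁))
    where
    bound≡ : 2 * a₁ k + a₂ k ≡ n + 2
    bound≡ = trans (sym (m∸n+n≡m (≤-trans (m≤n+m 2 n) n+2≤bound))) (cong (_+ 2) (sym n≡))
    counts≡ : 2 * N₁ + N₂ ≡ 2 * a₁ k + a₂ k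
    counts≡ = ≤-antisym counts≤ (subst (_≤ 2 * N₁ + N₂) (sym bound≡) (vertex-bound 1≤n))
    N₁≡a₁ : N₁ ≡ a₁ k
    N₁≡a₁ = proj₁ (tight-pair N₁≤a₁ N₂≤a₂ counts≡)
    N₂≡a₂ : N₂ ≡ a₂ k
    N₂≡a₂ = proj₂ (tight-pair N₁≤a₁ N₂≤a₂ counts≡)
    open Tight 1≤n (trans counts≡ bound≡)
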